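{- Let $\sigma=\sum_{k\ge0}a_kt^k\in\mathbb{F}_2[[t]]$ be the power series produced by a $2$-automaton $A$. Suppose there is a state $v$ of $A$ such that (1) there exist walks of arbitrarily large length from the start state to $v$, and (2) letting $v_0$ and $v_1$ be the states reached from $v$ along the edges labelled $0$ and $1$ respectively, and $A_i$ the automaton obtained from $A$ by making $v_i$ the start state, exactly one of the series produced by $A_0$ and $A_1$ is sparse. Then $\sigma\notin\hat S$.
   Context: A $2$-automaton is a finite directed graph whose states carry output labels in $\mathbb{F}_2$, with a start state and from each state exactly one outgoing edge labelled $0$ and one labelled $1$; it produces $\sum a_kt^k$ where $a_k$ is the output of the state reached from the start state by reading the binary digits of $k$ starting from the least significant digit. For $\tau=\sum b_kt^k$, $E(\tau)=\{k:b_k=1\}$; $\tau$ is sparse if $\#(E(\tau)\cap\{0,\dots,N\})=O((\log N)^r)$ for some $r\ge0$. $\hat S$ is the set of series in $\mathbb{F}_2[[t]]$ that are products of a sparse series and a rational function in $\mathbb{F}_2(t)$. -}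

module Defs where

open import Data.Nat using (ℕ; zero; suc; _+_; _*_; _^_; _≤_; _<_; _%_; _/_)
open import Data.Nat.Logarithm using (⌊log₂_⌋)
open import Data.Bool using (Bool; true; false; _xor_; _∧_)
open import Data.Fin using (Fin)
open import Data.List using (List; []; _∷_; length)
open import Data.Product using (Σ; ∃; _×_; _,_)
open import Relation.Binary.PropositionalEquality using (_≡_; _≢_)
open import Relation.Nullary using (¬_)

-- F₂ is modelled by Bool (xor = addition, ∧ = multiplication).
-- A power series in F₂[[t]] is its coefficient sequence ℕ → Bool.
Series : Set
Series = ℕ → Bool

-- A 2-automaton: finitely many states Fin n, an output label per state,
-- and from each state exactly one edge labelled 0 (false) and one labelled 1 (true).
record Automaton : Set where
  field
    n     : ℕ
    δ     : Fin n → Bool → Fin n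
    out   : Fin n → Bool
    start : Fin n
open Automaton public

bit : ℕ → Bool
bit k with k % 2
... | zero = false
... | suc _ = true

-- Read the binary digits of k from the least significant digit
-- (k = 0 has empty digit string); the first argument is fuel (k suffices).
readFuel : ∀ {m} → (Fin m → Bool → Fin m) → ℕ → Fin m → ℕ → Fin m
readFuel δ' zero    s k       = s
readFuel δ' (suc f) s zero    = s
readFuel δ' (suc f) s (suc k) = readFuel δ' f (δ' s (bit (suc k))) (suc k / 2)

reach : (A : Automaton) → Fin (n A) → ℕ → Fin (n A)
reach A s k = readFuel (δ A) k s k

produced : Automaton → Series
produced A k = out A (reach A (start A) k)

withStart : (A : Automaton) → Fin (n A) → Automaton
withStart A s = record { n = n A ; δ = δ A ; out = out A ; start = s }

runWord : (A : Automaton) → Fin (n A) → List Bool → Fin (n A)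
runWord A s []       = s
runWord A s (b ∷ bs) = runWord A (δ A s b) bs

count : Series → ℕ → ℕ
count τ zero    = if0 (τ zero)
  where
  if0 : Bool → ℕ
  if0 true  = 1
  if0 false = 0
count τ (suc N) = add (τ (suc N)) (count τ N)
  where
  add : Bool → ℕ → ℕ
  add true  m = suc m
  add false m = m

-- sparse: #(E(τ) ∩ {0..N}) = O((log N)^r) for some r ≥ 0
-- (log base 2, floored; the constant absorbs the change of base).
Sparse : Series → Set
Sparse τ = ∃ λ r → ∃ λ C → ∃ λ N₀ → ∀ N → N₀ ≤ N → count τ N ≤ C * (⌊log₂ N ⌋ ^ r)

sumTo : (ℕ → Bool) → ℕ → Bool
sumTo f zero    = f zero
sumTo f (suc k) = sumTo f k xor f (suc k)

_·_ : Series → Series → Series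
(f · g) k = sumTo (λ i → f i ∧ g (k Data.Nat.∸ i)) k

-- polynomials in F₂[t] as finitely supported series
IsPoly : Series → Set
IsPoly p = ∃ λ d → ∀ i → d < i → p i ≡ false

Nonzero : Series → Set
Nonzero q = ∃ λ i → q i ≡ true

-- σ ∈ Ŝ : σ = τ · (P/Q) with τ sparse and P, Q ∈ F₂[t], Q ≠ 0,
-- expressed without division as Q·σ = P·τ in F₂[[t]].
InŜ : Series → Set
InŜ σ = ∃ λ τ → ∃ λ P → ∃ λ Q →
  Sparse τ × IsPoly P × IsPoly Q × Nonzero Q × (∀ k → (Q · σ) k ≡ (P · τ) k)

{-# OPTIONS --safe #-}
-- Call g sparsely periodic with period K ≥ 1 when (1 + tᴷ) g is sparse. If Q σ = P τ with τ sparse, then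
-- outside the sparse support of P τ the coefficients of σ obey the linear recurrence given by Q; its
-- state map on F₂ᵈ is eventually periodic, so σ is sparsely periodic. The series produced from δ(p, b)
-- is eventually the 2-section Σₘ g₂ₘ₊ᵦ tᵐ of the series g produced from p, and sections halve even
-- periods, while odd ones survive because (1 + tᴷ)² = 1 + t²ᴷ. A walk of length ≥ K to v therefore
-- makes the series produced from v sparsely periodic with an odd period 2j + 1, and then
-- (1 + t²ʲ⁺¹) g sparse says that the two sections of g differ by a shift up to a sparse error: one
-- is sparse iff the other is.
module Submission where

open import Defs
open import Algebra.Properties.CommutativeSemigroup using (interchange)
open import Data.Bool using (Bool; true; false; not; _xor_; _∧_; _∨_)
open import Data.Bool.Properties using (∨-zeroʳ; ∧-zeroʳ; xor-identityʳ; xor-same; xor-assoc)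
open import Data.Fin using (Fin; toℕ; funToFin; finToFun)
open import Data.Fin.Properties using (pigeonhole; finToFun-funToFin; 2↔Bool)
open import Data.List using (List; []; _∷_; length)
open import Data.Nat using (ℕ; zero; suc; _+_; _*_; _^_; _≤_; _<_; _∸_; z≤n; s≤s; _≤?_; _%_; _/_)
open import Data.Nat.DivMod using (m/n<m; m*n%n≡0; [m+kn]%n≡m%n; m*n/n≡m; +-distrib-/)
open import Data.Nat.GeneralisedArithmetic using (fold)
open import Data.Nat.Logarithm using (⌊log₂_⌋; ⌊log₂⌋-mono-≤; ⌊log₂[2*b]⌋≡1+⌊log₂b⌋; ⌊log₂[2^n]⌋≡n)
open import Data.Nat.Properties
open import Data.Product using (∃; _×_; _,_; proj₁; proj₂)
open import Data.Sum using (_⊎_; inj₁; inj₂)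
open import Data.Vec using (Vec; []; _∷_; tabulate; lookup)
open import Data.Vec.Properties using (tabulate-cong; tabulate∘lookup)
open import Function using (_∘_; Inverse)
open import Relation.Binary.PropositionalEquality
open import Relation.Nullary using (¬_; yes; no)

∧-true : ∀ {a b} → a ∧ b ≡ true → a ≡ true × b ≡ true
∧-true {true} {true} _ = refl , refl

xor⇒∨ : ∀ {a b} → a xor b ≡ true → a ∨ b ≡ true
xor⇒∨ {true}  _   = refl
xor⇒∨ {false} a⊕b = a⊕b

xor-true-∨ : ∀ {d x y} → d ≡ x xor y → x ≡ true → d ∨ y ≡ true
xor-true-∨ {y = true}  _   _     = ∨-zeroʳ _
xor-true-∨ {y = false} d≡x refl rewrite d≡x = refl

xor-cancel-middle : ∀ a b c → (a xor b) xor (b xor c) ≡ a xor c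
xor-cancel-middle a b c = begin
  (a xor b) xor (b xor c) ≡⟨ xor-assoc a b (b xor c) ⟩
  a xor (b xor (b xor c)) ≡⟨ cong (a xor_) (xor-assoc b b c) ⟨
  a xor ((b xor b) xor c) ≡⟨ cong (λ x → a xor (x xor c)) (xor-same b) ⟩
  a xor c                 ∎
  where open ≡-Reasoning

xor-solve : ∀ {p s l} → p ≡ s xor l → s ≡ p xor l
xor-solve {s = s} {l} refl = sym (trans (xor-assoc s l l) (trans (cong (s xor_) (xor-same l)) (xor-identityʳ s)))

digit : Bool → ℕ
digit false = 0
digit true  = 1

digit≤1 : ∀ b → digit b ≤ 1
digit≤1 false = z≤n
digit≤1 true  = s≤s z≤n

digit-mono : ∀ {a b} → (a ≡ true → b ≡ true) → digit a ≤ digit b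
digit-mono {true}  a⇒b rewrite a⇒b refl = ≤-refl
digit-mono {false} a⇒b = z≤n

digit-∨ : ∀ a b → digit (a ∨ b) ≤ digit a + digit b
digit-∨ true  b = s≤s z≤n
digit-∨ false b = ≤-refl

-- As elements of F₂[[t]]: shift e f = tᵉ f, Δ K g = (1 + tᴷ) g and section b g = Σₘ g₂ₘ₊ᵦ tᵐ.

shift : ℕ → Series → Series
shift zero    f k       = f k
shift (suc e) f zero    = false
shift (suc e) f (suc k) = shift e f k

shift-≤ : ∀ e f k → e ≤ k → shift e f k ≡ f (k ∸ e)
shift-≤ zero    f k       _         = refl
shift-≤ (suc e) f (suc k) (s≤s e≤k) = shift-≤ e f k e≤k

shift-< : ∀ e f k → k < e → shift e f k ≡ false
shift-< (suc e) f zero    _         = refl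
shift-< (suc e) f (suc k) (s≤s k<e) = shift-< e f k k<e

shift-+ : ∀ i j g k → shift i (shift j g) k ≡ shift (i + j) g k
shift-+ zero    j g k       = refl
shift-+ (suc i) j g zero    = refl
shift-+ (suc i) j g (suc k) = shift-+ i j g k

shift-xor : ∀ K f g k → shift K (λ n → f n xor g n) k ≡ shift K f k xor shift K g k
shift-xor zero    f g k       = refl
shift-xor (suc K) f g zero    = refl
shift-xor (suc K) f g (suc k) = shift-xor K f g k

shift-≡ᵉ : ∀ K {g g′} k₀ → (∀ k → k₀ ≤ k → g k ≡ g′ k) →
  ∀ k → K + k₀ ≤ k → shift K g k ≡ shift K g′ k
shift-≡ᵉ zero    k₀ g≡g′ k       k₀≤k       = g≡g′ k k₀≤k
shift-≡ᵉ (suc K) k₀ g≡g′ zero    ()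
shift-≡ᵉ (suc K) k₀ g≡g′ (suc k) (s≤s K+k₀≤k) = shift-≡ᵉ K k₀ g≡g′ k K+k₀≤k

section : Bool → Series → Series
section b g m = g (digit b + m * 2)

shift-section : ∀ K g b m → shift (K * 2) g (digit b + m * 2) ≡ shift K (section b g) m
shift-section zero    g b     m       = refl
shift-section (suc K) g false zero    = refl
shift-section (suc K) g true  zero    = refl
shift-section (suc K) g false (suc m) = shift-section K g false m
shift-section (suc K) g true  (suc m) = shift-section K g true m

Δ : ℕ → Series → Series
Δ K g k = g k xor shift K g k

Δ-Δ : ∀ K g k → Δ K (Δ K g) k ≡ Δ (K + K) g k
Δ-Δ K g k = begin
  Δ K g k xor shift K (Δ K g) k                            ≡⟨ cong (Δ K g k xor_) (shift-xor K g (shift K g) k) ⟩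
  (g k xor shift K g k) xor (shift K g k xor shift K (shift K g) k)
                                                           ≡⟨ xor-cancel-middle (g k) _ _ ⟩
  g k xor shift K (shift K g) k                            ≡⟨ cong (g k xor_) (shift-+ K K g k) ⟩
  Δ (K + K) g k                                            ∎
  where open ≡-Reasoning

Δ-odd-section : ∀ j f b m →
  section (not b) (Δ (suc (j * 2)) f) m ≡ section (not b) f m xor shift (digit b + j) (section b f) m
Δ-odd-section j f false m       = cong (f (suc (m * 2)) xor_) (shift-section j f false m)
Δ-odd-section j f true  zero    = refl
Δ-odd-section j f true  (suc m) = cong (f (suc (suc (m * 2))) xor_) (shift-section j f true m)

window : ℕ → Series → Series
window zero    τ k = τ k
window (suc d) τ k = window d τ k ∨ shift (suc d) τ k

window-intro : ∀ τ d e k → e ≤ d → shift e τ k ≡ true → window d τ k ≡ true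
window-intro τ zero    zero k z≤n τk = τk
window-intro τ (suc d) e    k e≤d τk with m≤n⇒m<n∨m≡n e≤d
... | inj₁ (s≤s e≤d′) rewrite window-intro τ d e k e≤d′ τk = refl
... | inj₂ refl rewrite τk = ∨-zeroʳ _

window-elim : ∀ τ d e k → window d τ k ≡ false → e ≤ d → shift e τ k ≡ false
window-elim τ d e k w≡false e≤d with shift e τ k in eq
... | false = refl
... | true with () ← trans (sym w≡false) (window-intro τ d e k e≤d eq)

window-false : ∀ τ d j → window d τ (d + j) ≡ false → ∀ i → j ≤ i → i ≤ d + j → τ i ≡ false
window-false τ d j w≡false i j≤i i≤d+j = begin
  τ i                 ≡⟨ cong τ (m∸[m∸n]≡n i≤d+j) ⟨
  τ ((d + j) ∸ e)     ≡⟨ shift-≤ e τ (d + j) (m∸n≤m _ i) ⟨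
  shift e τ (d + j)   ≡⟨ window-elim τ d e (d + j) w≡false e≤d ⟩
  false               ∎
  where
  open ≡-Reasoning
  e = (d + j) ∸ i
  e≤d : e ≤ d
  e≤d = subst (e ≤_) (m+n∸n≡m d j) (∸-monoʳ-≤ (d + j) j≤i)

count-zero : ∀ f → count f 0 ≡ digit (f 0)
count-zero f with f 0
... | true  = refl
... | false = refl

count-suc : ∀ f N → count f (suc N) ≡ digit (f (suc N)) + count f N
count-suc f N with f (suc N)
... | true  = refl
... | false = refl

count≤1+ : ∀ f N → count f N ≤ suc N
count≤1+ f zero    rewrite count-zero f  = digit≤1 _
count≤1+ f (suc N) rewrite count-suc f N = +-mono-≤ (digit≤1 _) (count≤1+ f N)

digit≤count : ∀ f N → digit (f N) ≤ count f N
digit≤count f zero    rewrite count-zero f  = ≤-refl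
digit≤count f (suc N) rewrite count-suc f N = m≤m+n _ _

count-mono : ∀ f {M N} → M ≤ N → count f M ≤ count f N
count-mono f {M} {zero}  z≤n = ≤-refl
count-mono f {M} {suc N} M≤1+N with m≤n⇒m<n∨m≡n M≤1+N
... | inj₂ refl = ≤-refl
... | inj₁ (s≤s M≤N) rewrite count-suc f N = ≤-trans (count-mono f M≤N) (m≤n+m _ _)

count-step : ∀ f {M N} → M < N → digit (f N) + count f M ≤ count f N
count-step f {N = suc N} (s≤s M≤N) rewrite count-suc f N = +-monoʳ-≤ _ (count-mono f M≤N)

count-⊆ᵉ : ∀ f g k₀ → (∀ k → k₀ ≤ k → g k ≡ true → f k ≡ true) → ∀ N → count g N ≤ count f N + k₀
count-⊆ᵉ f g k₀ g⊆f N with k₀ ≤? N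
... | no N<k₀ = ≤-trans (count≤1+ g N) (≤-trans (≰⇒> N<k₀) (m≤n+m k₀ _))
count-⊆ᵉ f g k₀ g⊆f zero    | yes k₀≤0 rewrite count-zero g | count-zero f =
  ≤-trans (digit-mono (g⊆f 0 k₀≤0)) (m≤m+n _ _)
count-⊆ᵉ f g k₀ g⊆f (suc N) | yes k₀≤N
  rewrite count-suc g N | count-suc f N | +-assoc (digit (f (suc N))) (count f N) k₀ =
  +-mono-≤ (digit-mono (g⊆f (suc N) k₀≤N)) (count-⊆ᵉ f g k₀ g⊆f N)

count-∨ : ∀ f g N → count (λ k → f k ∨ g k) N ≤ count f N + count g N
count-∨ f g zero rewrite count-zero (λ k → f k ∨ g k) | count-zero f | count-zero g = digit-∨ (f 0) (g 0)
count-∨ f g (suc N) rewrite count-suc (λ k → f k ∨ g k) N | count-suc f N | count-suc g N =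
  ≤-trans (+-mono-≤ (digit-∨ (f (suc N)) (g (suc N))) (count-∨ f g N))
          (≤-reflexive (interchange +-commutativeSemigroup (digit (f (suc N))) (digit (g (suc N))) (count f N) (count g N)))

count-∘ : ∀ (f : Series) (h : ℕ → ℕ) → (∀ k → h k < h (suc k)) →
  ∀ N → count (λ k → f (h k)) N ≤ count f (h N)
count-∘ f h h-inc zero rewrite count-zero (λ k → f (h k)) = digit≤count f (h 0)
count-∘ f h h-inc (suc N) rewrite count-suc (λ k → f (h k)) N =
  ≤-trans (+-monoʳ-≤ _ (count-∘ f h h-inc N)) (count-step f (h-inc N))

count-shift-suc : ∀ e f N → count (shift (suc e) f) (suc N) ≡ count (shift e f) N
count-shift-suc e f zero
  rewrite count-suc (shift (suc e) f) 0 | count-zero (shift (suc e) f) | count-zero (shift e f) = +-identityʳ _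
count-shift-suc e f (suc N)
  rewrite count-suc (shift (suc e) f) (suc N) | count-suc (shift e f) N | count-shift-suc e f N = refl

count-shift : ∀ e f N → count (shift e f) N ≤ count f N
count-shift zero    f N = ≤-refl
count-shift (suc e) f N = begin
  count (shift (suc e) f) N       ≤⟨ count-mono (shift (suc e) f) (n≤1+n N) ⟩
  count (shift (suc e) f) (suc N) ≡⟨ count-shift-suc e f N ⟩
  count (shift e f) N             ≤⟨ count-shift e f N ⟩
  count f N                       ∎
  where open ≤-Reasoning

1≤^ : ∀ {x} r → 1 ≤ x → 1 ≤ x ^ r
1≤^ {x} r 1≤x = subst (_≤ x ^ r) (^-zeroˡ r) (^-monoˡ-≤ r 1≤x)

1≤⌊log₂⌋ : ∀ {N} → 2 ≤ N → 1 ≤ ⌊log₂ N ⌋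
1≤⌊log₂⌋ {N} 2≤N = subst (_≤ ⌊log₂ N ⌋) (⌊log₂[2^n]⌋≡n 1) (⌊log₂⌋-mono-≤ 2≤N)

⌊log₂[4*n]⌋≡2+⌊log₂n⌋ : ∀ n → ⌊log₂ (4 * suc n) ⌋ ≡ 2 + ⌊log₂ (suc n) ⌋
⌊log₂[4*n]⌋≡2+⌊log₂n⌋ n = begin
  ⌊log₂ (4 * suc n) ⌋       ≡⟨ cong ⌊log₂_⌋ (*-assoc 2 2 (suc n)) ⟩
  ⌊log₂ (2 * (2 * suc n)) ⌋ ≡⟨ ⌊log₂[2*b]⌋≡1+⌊log₂b⌋ (2 * suc n) ⟩
  1 + ⌊log₂ (2 * suc n) ⌋   ≡⟨ cong suc (⌊log₂[2*b]⌋≡1+⌊log₂b⌋ (suc n)) ⟩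
  2 + ⌊log₂ (suc n) ⌋       ∎
  where open ≡-Reasoning

*-distrib-^ : ∀ a b r → (a * b) ^ r ≡ a ^ r * b ^ r
*-distrib-^ a b zero    = refl
*-distrib-^ a b (suc r) =
  trans (cong (a * b *_) (*-distrib-^ a b r)) (interchange *-commutativeSemigroup a b (a ^ r) (b ^ r))

Sparse-reindex : ∀ {f g} (h : ℕ → ℕ) N₁ c →
  (∀ N → N₁ ≤ N → N ≤ h N × h N ≤ 4 * N) →
  (∀ N → count g N ≤ count f (h N) + c) → Sparse f → Sparse g
Sparse-reindex {f} {g} h N₁ c h-bounds g≤f (r , C , N₀ , f-sparse) =
  r , C * 3 ^ r + c , N₀ + N₁ + 2 , g-sparse
  where
  g-sparse : ∀ N → N₀ + N₁ + 2 ≤ N → count g N ≤ (C * 3 ^ r + c) * ⌊log₂ N ⌋ ^ r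
  g-sparse zero p with () ← m+n≤o⇒n≤o (N₀ + N₁) p
  g-sparse (suc n) p = begin
    count g N                             ≤⟨ g≤f N ⟩
    count f (h N) + c                     ≤⟨ +-monoˡ-≤ c (f-sparse (h N) (≤-trans N₀≤N (proj₁ (h-bounds N N₁≤N)))) ⟩
    C * ⌊log₂ (h N) ⌋ ^ r + c             ≤⟨ +-mono-≤ (*-monoʳ-≤ C (^-monoˡ-≤ r log-h≤)) c≤c*L^r ⟩
    C * (3 * L) ^ r + c * L ^ r           ≡⟨ cong (λ x → C * x + c * L ^ r) (*-distrib-^ 3 L r) ⟩
    C * (3 ^ r * L ^ r) + c * L ^ r       ≡⟨ cong (_+ c * L ^ r) (sym (*-assoc C (3 ^ r) (L ^ r))) ⟩
    C * 3 ^ r * L ^ r + c * L ^ r         ≡⟨ sym (*-distribʳ-+ (L ^ r) (C * 3 ^ r) c) ⟩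
    (C * 3 ^ r + c) * L ^ r               ∎
    where
    open ≤-Reasoning
    N = suc n
    L = ⌊log₂ N ⌋
    N₀≤N = m+n≤o⇒m≤o N₀ (m+n≤o⇒m≤o (N₀ + N₁) p)
    N₁≤N = m+n≤o⇒n≤o N₀ (m+n≤o⇒m≤o (N₀ + N₁) p)
    1≤L = 1≤⌊log₂⌋ (m+n≤o⇒n≤o (N₀ + N₁) p)
    log-h≤ : ⌊log₂ (h N) ⌋ ≤ 3 * L
    log-h≤ = begin
      ⌊log₂ (h N) ⌋     ≤⟨ ⌊log₂⌋-mono-≤ (proj₂ (h-bounds N N₁≤N)) ⟩
      ⌊log₂ (4 * N) ⌋   ≡⟨ ⌊log₂[4*n]⌋≡2+⌊log₂n⌋ n ⟩
      2 + L             ≤⟨ +-monoˡ-≤ L (*-monoʳ-≤ 2 1≤L) ⟩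
      2 * L + L         ≡⟨ +-comm (2 * L) L ⟩
      3 * L             ∎
    c≤c*L^r : c ≤ c * L ^ r
    c≤c*L^r = subst (_≤ c * L ^ r) (*-identityʳ c) (*-monoʳ-≤ c (1≤^ r 1≤L))

Sparse-≤ : ∀ {f g} c → (∀ N → count g N ≤ count f N + c) → Sparse f → Sparse g
Sparse-≤ c = Sparse-reindex (λ N → N) 0 c (λ N _ → ≤-refl , m≤n*m N 4)

Sparse-⊆ᵉ : ∀ {f g} k₀ → (∀ k → k₀ ≤ k → g k ≡ true → f k ≡ true) → Sparse f → Sparse g
Sparse-⊆ᵉ {f} {g} k₀ g⊆f = Sparse-≤ k₀ (count-⊆ᵉ f g k₀ g⊆f)

Sparse-≡ᵉ : ∀ {f g} k₀ → (∀ k → k₀ ≤ k → f k ≡ g k) → Sparse f → Sparse g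
Sparse-≡ᵉ k₀ f≡g = Sparse-⊆ᵉ k₀ (λ k k₀≤k gk → trans (f≡g k k₀≤k) gk)

Sparse-shift : ∀ {f} e → Sparse f → Sparse (shift e f)
Sparse-shift {f} e = Sparse-≤ 0 (λ N → ≤-trans (count-shift e f N) (m≤m+n _ 0))

Sparse-∘ : ∀ {f} (h : ℕ → ℕ) N₁ → (∀ k → h k < h (suc k)) → (∀ N → N₁ ≤ N → h N ≤ 4 * N) →
  Sparse f → Sparse (λ k → f (h k))
Sparse-∘ {f} h N₁ h-inc h≤4* =
  Sparse-reindex h N₁ 0 (λ N N₁≤N → n≤h N , h≤4* N N₁≤N) (λ N → ≤-trans (count-∘ f h h-inc N) (m≤m+n _ 0))
  where
  n≤h : ∀ N → N ≤ h N
  n≤h zero    = z≤n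
  n≤h (suc N) = ≤-trans (s≤s (n≤h N)) (h-inc N)

Sparse-section : ∀ {g} b → Sparse g → Sparse (section b g)
Sparse-section {g} b = Sparse-∘ (λ m → digit b + m * 2) 1 step bound
  where
  step : ∀ m → digit b + m * 2 < digit b + suc m * 2
  step m = +-monoʳ-< (digit b) (m<n+m (m * 2) {2} (s≤s z≤n))
  bound : ∀ m → 1 ≤ m → digit b + m * 2 ≤ 4 * m
  bound m 1≤m = begin
    digit b + m * 2  ≤⟨ +-monoˡ-≤ (m * 2) (≤-trans (digit≤1 b) (≤-trans 1≤m (m≤m*n m 2))) ⟩
    m * 2 + m * 2    ≡⟨ *-distribˡ-+ m 2 2 ⟨
    m * 4            ≡⟨ *-comm m 4 ⟩
    4 * m            ∎
    where open ≤-Reasoning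

Sparse-∨ : ∀ {f g} → Sparse f → Sparse g → Sparse (λ k → f k ∨ g k)
Sparse-∨ {f} {g} (r₁ , C₁ , N₁ , f-sparse) (r₂ , C₂ , N₂ , g-sparse) =
  r₁ + r₂ , C₁ + C₂ , N₁ + N₂ + 2 , bound
  where
  bound : ∀ N → N₁ + N₂ + 2 ≤ N → count (λ k → f k ∨ g k) N ≤ (C₁ + C₂) * ⌊log₂ N ⌋ ^ (r₁ + r₂)
  bound N p = begin
    count (λ k → f k ∨ g k) N         ≤⟨ count-∨ f g N ⟩
    count f N + count g N             ≤⟨ +-mono-≤ (f-sparse N N₁≤N) (g-sparse N N₂≤N) ⟩
    C₁ * L ^ r₁ + C₂ * L ^ r₂         ≤⟨ +-mono-≤ (*-monoʳ-≤ C₁ (L^≤L^+ r₁ r₂)) (*-monoʳ-≤ C₂ L^r₂≤) ⟩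
    C₁ * L ^ (r₁ + r₂) + C₂ * L ^ (r₁ + r₂) ≡⟨ sym (*-distribʳ-+ (L ^ (r₁ + r₂)) C₁ C₂) ⟩
    (C₁ + C₂) * L ^ (r₁ + r₂)         ∎
    where
    open ≤-Reasoning
    L = ⌊log₂ N ⌋
    N₁≤N = m+n≤o⇒m≤o N₁ (m+n≤o⇒m≤o (N₁ + N₂) p)
    N₂≤N = m+n≤o⇒n≤o N₁ (m+n≤o⇒m≤o (N₁ + N₂) p)
    1≤L = 1≤⌊log₂⌋ (m+n≤o⇒n≤o (N₁ + N₂) p)
    L^≤L^+ : ∀ a b → L ^ a ≤ L ^ (a + b)
    L^≤L^+ a b = begin
      L ^ a         ≡⟨ *-identityʳ (L ^ a) ⟨
      L ^ a * 1     ≤⟨ *-monoʳ-≤ (L ^ a) (1≤^ b 1≤L) ⟩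
      L ^ a * L ^ b ≡⟨ ^-distribˡ-+-* L a b ⟨
      L ^ (a + b)   ∎
    L^r₂≤ : L ^ r₂ ≤ L ^ (r₁ + r₂)
    L^r₂≤ = subst (λ x → L ^ r₂ ≤ L ^ x) (+-comm r₂ r₁) (L^≤L^+ r₂ r₁)

Sparse-Δ : ∀ {f} K → Sparse f → Sparse (Δ K f)
Sparse-Δ {f} K f-sparse = Sparse-⊆ᵉ 0 (λ k _ → xor⇒∨ {f k}) (Sparse-∨ f-sparse (Sparse-shift K f-sparse))

Sparse-window : ∀ {τ} d → Sparse τ → Sparse (window d τ)
Sparse-window zero    τ-sparse = τ-sparse
Sparse-window (suc d) τ-sparse = Sparse-∨ (Sparse-window d τ-sparse) (Sparse-shift (suc d) τ-sparse)

sumTo-true : ∀ h k → sumTo h k ≡ true → ∃ λ i → i ≤ k × h i ≡ true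
sumTo-true h zero    h0 = 0 , z≤n , h0
sumTo-true h (suc k) s with h (suc k) in eq
... | true  = suc k , ≤-refl , eq
... | false with sumTo-true h k (trans (sym (xor-identityʳ _)) s)
...   | i , i≤k , hi = i , m≤n⇒m≤1+n i≤k , hi

Sparse-poly· : ∀ {P τ} → IsPoly P → Sparse τ → Sparse (P · τ)
Sparse-poly· {P} {τ} (d , P-deg) τ-sparse = Sparse-⊆ᵉ 0 Pτ⊆window (Sparse-window d τ-sparse)
  where
  Pτ⊆window : ∀ k → 0 ≤ k → (P · τ) k ≡ true → window d τ k ≡ true
  Pτ⊆window k _ Pτk with sumTo-true (λ i → P i ∧ τ (k ∸ i)) k Pτk
  ... | i , i≤k , Piτ with ∧-true Piτ | i ≤? d
  ...   | Pi , τk-i | yes i≤d = window-intro τ d i k i≤d (trans (shift-≤ i τ k i≤k) τk-i)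
  ...   | Pi , _    | no  d<i with () ← trans (sym (P-deg i (≰⇒> d<i))) Pi

SparselyPeriodic : ℕ → Series → Set
SparselyPeriodic K g = Sparse (Δ K g)

SparselyPeriodic-*2 : ∀ {g} K → SparselyPeriodic K g → SparselyPeriodic (K * 2) g
SparselyPeriodic-*2 {g} K K-periodic =
  subst (λ L → SparselyPeriodic L g) K+K≡K*2 (Sparse-≡ᵉ 0 (λ k _ → Δ-Δ K g k) (Sparse-Δ K K-periodic))
  where
  K+K≡K*2 : K + K ≡ K * 2
  K+K≡K*2 = trans (cong (K +_) (sym (+-identityʳ K))) (*-comm 2 K)

SparselyPeriodic-section : ∀ {g} K b → SparselyPeriodic (K * 2) g → SparselyPeriodic K (section b g)
SparselyPeriodic-section {g} K b =
  Sparse-≡ᵉ 0 (λ m _ → cong (section b g m xor_) (shift-section K g b m)) ∘ Sparse-section b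

SparselyPeriodic-≡ᵉ : ∀ {g g′} K k₀ → (∀ k → k₀ ≤ k → g k ≡ g′ k) →
  SparselyPeriodic K g → SparselyPeriodic K g′
SparselyPeriodic-≡ᵉ K k₀ g≡g′ = Sparse-≡ᵉ (K + k₀) λ k K+k₀≤k →
  cong₂ _xor_ (g≡g′ k (m+n≤o⇒n≤o K K+k₀≤k)) (shift-≡ᵉ K k₀ g≡g′ k K+k₀≤k)

SparselyPeriodic-odd-section : ∀ {f} j b → SparselyPeriodic (suc (j * 2)) f →
  Sparse (section b f) → Sparse (section (not b) f)
SparselyPeriodic-odd-section {f} j b periodic b-sparse =
  Sparse-⊆ᵉ 0 (λ m _ → xor-true-∨ (Δ-odd-section j f b m))
    (Sparse-∨ (Sparse-section (not b) periodic) (Sparse-shift (digit b + j) b-sparse))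

EventuallyPeriodic : ∀ {X : Set} → (X → X) → Set
EventuallyPeriodic {X} f = ∃ λ i → ∃ λ K → 1 ≤ K × (∀ x → fold x f (K + i) ≡ fold x f i)

fold-eventuallyPeriodic-Fin : ∀ {N} (f : Fin N → Fin N) → EventuallyPeriodic f
fold-eventuallyPeriodic-Fin {N} f
  with i , j , i<j , fᶦ≡fʲ ← pigeonhole (n<1+n (N ^ N)) (λ k → funToFin (λ x → fold x f (toℕ k))) =
  toℕ i , toℕ j ∸ toℕ i , m<n⇒0<n∸m i<j , λ x → begin
    fold x f (toℕ j ∸ toℕ i + toℕ i)                   ≡⟨ cong (fold x f) (m∸n+n≡m (<⇒≤ i<j)) ⟩
    fold x f (toℕ j)                                   ≡⟨ finToFun-funToFin (λ y → fold y f (toℕ j)) x ⟨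
    finToFun (funToFin (λ y → fold y f (toℕ j))) x     ≡⟨ cong (λ g → finToFun g x) fᶦ≡fʲ ⟨
    finToFun (funToFin (λ y → fold y f (toℕ i))) x     ≡⟨ finToFun-funToFin (λ y → fold y f (toℕ i)) x ⟩
    fold x f (toℕ i)                                   ∎
  where open ≡-Reasoning

fold-eventuallyPeriodic-retract : ∀ {X : Set} {N} (encode : X → Fin N) (decode : Fin N → X) →
  (∀ x → decode (encode x) ≡ x) → (f : X → X) → EventuallyPeriodic f
fold-eventuallyPeriodic-retract encode decode retract f
  with i , K , 1≤K , periodic ← fold-eventuallyPeriodic-Fin (encode ∘ f ∘ decode) =
  i , K , 1≤K , λ x → begin
    fold x f (K + i)                      ≡⟨ decode-fold x (K + i) ⟨
    decode (fold (encode x) f′ (K + i))   ≡⟨ cong decode (periodic (encode x)) ⟩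
    decode (fold (encode x) f′ i)         ≡⟨ decode-fold x i ⟩
    fold x f i                            ∎
  where
  open ≡-Reasoning
  f′ = encode ∘ f ∘ decode
  decode-fold : ∀ x n → decode (fold (encode x) f′ n) ≡ fold x f n
  decode-fold x zero    = retract x
  decode-fold x (suc n) = trans (retract _) (cong f (decode-fold x n))

fold-eventuallyPeriodic-Vec : ∀ {d} (f : Vec Bool d → Vec Bool d) → EventuallyPeriodic f
fold-eventuallyPeriodic-Vec {d} = fold-eventuallyPeriodic-retract encode decode decode-encode
  where
  open Inverse 2↔Bool
  encode : Vec Bool d → Fin (2 ^ d)
  encode v = funToFin (from ∘ lookup v)
  decode : Fin (2 ^ d) → Vec Bool d
  decode k = tabulate (to ∘ finToFun k)
  decode-encode : ∀ v → decode (encode v) ≡ v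
  decode-encode v = trans (tabulate-cong λ i → trans (cong to (finToFun-funToFin (from ∘ lookup v) i))
                                                      (strictlyInverseˡ (lookup v i)))
                          (tabulate∘lookup v)

sumBelow : Series → ℕ → Bool
sumBelow h zero    = false
sumBelow h (suc m) = h 0 xor sumBelow (h ∘ suc) m

sumBelow-suc : ∀ h m → sumBelow h (suc m) ≡ sumBelow h m xor h m
sumBelow-suc h zero    = xor-identityʳ (h 0)
sumBelow-suc h (suc m) = trans (cong (h 0 xor_) (sumBelow-suc (h ∘ suc) m)) (sym (xor-assoc (h 0) _ _))

sumTo≡sumBelow : ∀ h k → sumTo h k ≡ sumBelow h (suc k)
sumTo≡sumBelow h zero    = sym (xor-identityʳ (h 0))
sumTo≡sumBelow h (suc k) = trans (cong (_xor h (suc k)) (sumTo≡sumBelow h k)) (sym (sumBelow-suc h (suc k)))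

sumBelow-cong : ∀ {g h} m → (∀ i → i < m → g i ≡ h i) → sumBelow g m ≡ sumBelow h m
sumBelow-cong zero    _   = refl
sumBelow-cong (suc m) g≡h = cong₂ _xor_ (g≡h 0 (s≤s z≤n)) (sumBelow-cong m (λ i i<m → g≡h (suc i) (s≤s i<m)))

sumBelow-+ : ∀ h a m → (∀ i → i < a → h i ≡ false) → sumBelow h (a + m) ≡ sumBelow (λ i → h (a + i)) m
sumBelow-+ h zero    m _     = refl
sumBelow-+ h (suc a) m zeros rewrite zeros 0 (s≤s z≤n) =
  sumBelow-+ (h ∘ suc) a m (λ i i<a → zeros (suc i) (s≤s i<a))

sumBelow-vanishing : ∀ h {m m′} → (∀ i → m ≤ i → h i ≡ false) → m ≤ m′ → sumBelow h m′ ≡ sumBelow h m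
sumBelow-vanishing h {m} zeros m≤m′ with m≤n⇒m<n∨m≡n m≤m′
... | inj₂ refl = refl
... | inj₁ (s≤s {n = m″} m≤m″) = begin
  sumBelow h (suc m″)     ≡⟨ sumBelow-suc h m″ ⟩
  sumBelow h m″ xor h m″  ≡⟨ cong (sumBelow h m″ xor_) (zeros m″ m≤m″) ⟩
  sumBelow h m″ xor false ≡⟨ xor-identityʳ _ ⟩
  sumBelow h m″           ≡⟨ sumBelow-vanishing h zeros m≤m″ ⟩
  sumBelow h m            ∎
  where open ≡-Reasoning

sumBelow-vanishing₂ : ∀ h {m m′} → (∀ i → m ≤ i → h i ≡ false) → (∀ i → m′ ≤ i → h i ≡ false) →
  sumBelow h m ≡ sumBelow h m′
sumBelow-vanishing₂ h {m} {m′} zeros zeros′ with ≤-total m m′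
... | inj₁ m≤m′ = sym (sumBelow-vanishing h zeros m≤m′)
... | inj₂ m′≤m = sumBelow-vanishing h zeros′ m′≤m

·-drop : ∀ Q σ a → (∀ i → i < a → Q i ≡ false) → ∀ k → (Q · σ) (a + k) ≡ ((λ i → Q (a + i)) · σ) k
·-drop Q σ a below k = begin
  sumTo h (a + k)                          ≡⟨ sumTo≡sumBelow h (a + k) ⟩
  sumBelow h (suc (a + k))                 ≡⟨ cong (sumBelow h) (+-suc a k) ⟨
  sumBelow h (a + suc k)                   ≡⟨ sumBelow-+ h a (suc k) (λ i i<a → cong (_∧ _) (below i i<a)) ⟩
  sumBelow (λ i → h (a + i)) (suc k)       ≡⟨ sumBelow-cong (suc k) (λ i _ → cong (λ n → Q (a + i) ∧ σ n)
                                                                             ([m+n]∸[m+o]≡n∸o a k i)) ⟩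
  sumBelow (λ i → Q (a + i) ∧ σ (k ∸ i)) (suc k) ≡⟨ sumTo≡sumBelow (λ i → Q (a + i) ∧ σ (k ∸ i)) k ⟨
  ((λ i → Q (a + i)) · σ) k                ∎
  where
  open ≡-Reasoning
  h = λ i → Q i ∧ σ ((a + k) ∸ i)

coeffs : Series → (m : ℕ) → Vec Bool m
coeffs f zero    = []
coeffs f (suc m) = f 0 ∷ coeffs (f ∘ suc) m

push : ∀ {m} → Bool → Vec Bool m → Vec Bool m
push b []       = []
push b (x ∷ xs) = b ∷ push x xs

coeffs-push : ∀ f m → coeffs f m ≡ push (f 0) (coeffs (f ∘ suc) m)
coeffs-push f zero    = refl
coeffs-push f (suc m) = cong (f 0 ∷_) (coeffs-push (f ∘ suc) m)

dot : ∀ {m} → Series → Vec Bool m → Bool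
dot a []       = false
dot a (x ∷ xs) = (a 0 ∧ x) xor dot (a ∘ suc) xs

dot-coeffs : ∀ a f m → dot a (coeffs f m) ≡ sumBelow (λ i → a i ∧ f i) m
dot-coeffs a f zero    = refl
dot-coeffs a f (suc m) = cong ((a 0 ∧ f 0) xor_) (dot-coeffs (a ∘ suc) (f ∘ suc) m)

module LinearRecurrence (c : Series) (d : ℕ) (c₀ : c 0 ≡ true) (c-deg : ∀ i → d < i → c i ≡ false)
                        (σ π : Series) (recurrence : ∀ k → (c · σ) k ≡ π k) where

  -- state k = (σₖ₋₁, …, σₖ₋d), reading σᵢ = 0 for i < 0; it is advanced by next wherever π vanishes.
  state : ℕ → Vec Bool d
  state k = coeffs (λ i → shift (suc i) σ k) d

  feedback : Vec Bool d → Bool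
  feedback = dot (c ∘ suc)

  next : Vec Bool d → Vec Bool d
  next w = push (feedback w) w

  σ≡π+feedback : ∀ k → σ k ≡ π k xor feedback (state k)
  σ≡π+feedback k = xor-solve (begin
    π k                                    ≡⟨ recurrence k ⟨
    sumTo h k                              ≡⟨ sumTo≡sumBelow h k ⟩
    (c 0 ∧ σ k) xor sumBelow (h ∘ suc) k   ≡⟨ cong₂ _xor_ (cong (_∧ σ k) c₀) (sumBelow-cong k h≡g) ⟩
    σ k xor sumBelow g k                   ≡⟨ cong (σ k xor_) (sumBelow-vanishing₂ g g-beyond-k g-beyond-d) ⟩
    σ k xor sumBelow g d                   ≡⟨ cong (σ k xor_) (dot-coeffs (c ∘ suc) (λ i → shift (suc i) σ k) d) ⟨
    σ k xor feedback (state k)             ∎)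
    where
    open ≡-Reasoning
    h = λ i → c i ∧ σ (k ∸ i)
    g = λ i → c (suc i) ∧ shift (suc i) σ k
    h≡g : ∀ i → i < k → h (suc i) ≡ g i
    h≡g i i<k = cong (c (suc i) ∧_) (sym (shift-≤ (suc i) σ k i<k))
    g-beyond-k : ∀ i → k ≤ i → g i ≡ false
    g-beyond-k i k≤i = trans (cong (c (suc i) ∧_) (shift-< (suc i) σ k (s≤s k≤i))) (∧-zeroʳ _)
    g-beyond-d : ∀ i → d ≤ i → g i ≡ false
    g-beyond-d i d≤i = cong (_∧ _) (c-deg (suc i) (s≤s d≤i))

  state-suc : ∀ k → π k ≡ false → state (suc k) ≡ next (state k)
  state-suc k πk≡false = trans (coeffs-push (λ i → shift i σ k) d)
    (cong (λ b → push b (state k)) (trans (σ≡π+feedback k) (cong (_xor feedback (state k)) πk≡false)))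

  state-fold : ∀ n j → (∀ i → j ≤ i → i < n + j → π i ≡ false) → state (n + j) ≡ fold (state j) next n
  state-fold zero    j _     = refl
  state-fold (suc n) j zeros = trans (state-suc (n + j) (zeros (n + j) (m≤n+m j n) ≤-refl))
    (cong next (state-fold n j (λ i j≤i i<n+j → zeros i j≤i (m<n⇒m<1+n i<n+j))))

  -- E = K + i₀ steps of the recurrence return the state to where it was after i₀ steps, so across a
  -- stretch of E + 1 zeros of π the series σ repeats with period K.
  module _ {i₀ K} (periodic : ∀ w → fold w next (K + i₀) ≡ fold w next i₀) where

    σ-gap : ∀ j → (∀ i → j ≤ i → i ≤ K + i₀ + j → π i ≡ false) → σ (K + i₀ + j) ≡ σ (i₀ + j)
    σ-gap j zeros = begin
      σ (E + j)                                   ≡⟨ σ≡π+feedback (E + j) ⟩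
      π (E + j) xor feedback (state (E + j))      ≡⟨ cong₂ _xor_ (zeros (E + j) (m≤n+m j E) ≤-refl)
                                                       (cong feedback (state-fold E j zeros-E)) ⟩
      false xor feedback (fold (state j) next E)  ≡⟨ cong feedback (periodic (state j)) ⟩
      feedback (fold (state j) next i₀)           ≡⟨ cong feedback (state-fold i₀ j zeros-i₀) ⟨
      false xor feedback (state (i₀ + j))         ≡⟨ cong (_xor feedback (state (i₀ + j)))
                                                       (zeros (i₀ + j) (m≤n+m j i₀) i₀+j≤E+j) ⟨
      π (i₀ + j) xor feedback (state (i₀ + j))    ≡⟨ σ≡π+feedback (i₀ + j) ⟨
      σ (i₀ + j)                                  ∎
      where
      open ≡-Reasoning
      E = K + i₀
      i₀+j≤E+j = +-monoˡ-≤ j (m≤n+m i₀ K)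
      zeros-E : ∀ i → j ≤ i → i < E + j → π i ≡ false
      zeros-E i j≤i i<E+j = zeros i j≤i (<⇒≤ i<E+j)
      zeros-i₀ : ∀ i → j ≤ i → i < i₀ + j → π i ≡ false
      zeros-i₀ i j≤i i<i₀+j = zeros i j≤i (≤-trans (<⇒≤ i<i₀+j) i₀+j≤E+j)

    Δ-gap : ∀ j → window (K + i₀) π (K + i₀ + j) ≡ false → Δ K σ (K + i₀ + j) ≡ false
    Δ-gap j w≡false = begin
      σ (E + j) xor shift K σ (E + j)   ≡⟨ cong₂ _xor_ (σ-gap j (window-false π E j w≡false))
                                                       (shift-≤ K σ (E + j) K≤E+j) ⟩
      σ (i₀ + j) xor σ (E + j ∸ K)      ≡⟨ cong (λ n → σ (i₀ + j) xor σ n) E+j∸K≡i₀+j ⟩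
      σ (i₀ + j) xor σ (i₀ + j)         ≡⟨ xor-same (σ (i₀ + j)) ⟩
      false                             ∎
      where
      open ≡-Reasoning
      E = K + i₀
      K≤E+j = ≤-trans (m≤m+n K i₀) (m≤m+n E j)
      E+j∸K≡i₀+j = trans (cong (_∸ K) (+-assoc K i₀ j)) (m+n∸m≡n K (i₀ + j))

    Δ⊆window-+ : ∀ j → Δ K σ (K + i₀ + j) ≡ true → window (K + i₀) π (K + i₀ + j) ≡ true
    Δ⊆window-+ j Δ≡true with window (K + i₀) π (K + i₀ + j) in w
    ... | true  = refl
    ... | false with () ← trans (sym Δ≡true) (Δ-gap j w)

    Δ⊆window : ∀ k → K + i₀ ≤ k → Δ K σ k ≡ true → window (K + i₀) π k ≡ true
    Δ⊆window k E≤k = subst (λ n → Δ K σ n ≡ true → window (K + i₀) π n ≡ true) (m+[n∸m]≡n E≤k)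
                           (Δ⊆window-+ (k ∸ (K + i₀)))

  sparselyPeriodic : Sparse π → ∃ λ K → 1 ≤ K × SparselyPeriodic K σ
  sparselyPeriodic π-sparse with i₀ , K , 1≤K , periodic ← fold-eventuallyPeriodic-Vec next =
    K , 1≤K , Sparse-⊆ᵉ (K + i₀) (Δ⊆window {i₀} {K} periodic) (Sparse-window (K + i₀) π-sparse)

first-true : ∀ (f : Series) i → f i ≡ true → ∃ λ a → f a ≡ true × (∀ j → j < a → f j ≡ false)
first-true f zero    f0 = 0 , f0 , λ _ ()
first-true f (suc i) fi with f 0 in f0
... | true  = 0 , f0 , λ _ ()
... | false with a , fa , below ← first-true (f ∘ suc) i fi =
  suc a , fa , λ { zero _ → f0 ; (suc j) (s≤s j<a) → below j j<a }

InŜ⇒SparselyPeriodic : ∀ σ → InŜ σ → ∃ λ K → 1 ≤ K × SparselyPeriodic K σ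
InŜ⇒SparselyPeriodic σ (τ , P , Q , τ-sparse , P-poly , (dQ , Q-deg) , (i , Qi) , Qσ≡Pτ)
  with a , Qa , below ← first-true Q i Qi =
  LinearRecurrence.sparselyPeriodic c dQ c₀ c-deg σ π recurrence
    (Sparse-∘ (a +_) a (λ k → +-monoʳ-< a (n<1+n k)) a+N≤4N (Sparse-poly· P-poly τ-sparse))
  where
  -- Q = tᵃ c with c 0 = 1, and cσ = π := t⁻ᵃ P τ.
  c π : Series
  c i = Q (a + i)
  π k = (P · τ) (a + k)
  c₀ : c 0 ≡ true
  c₀ = subst (λ n → Q n ≡ true) (sym (+-identityʳ a)) Qa
  c-deg : ∀ i → dQ < i → c i ≡ false
  c-deg i dQ<i = Q-deg (a + i) (≤-trans dQ<i (m≤n+m i a))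
  recurrence : ∀ k → (c · σ) k ≡ π k
  recurrence k = trans (sym (·-drop Q σ a below k)) (Qσ≡Pτ (a + k))
  a+N≤4N : ∀ N → a ≤ N → a + N ≤ 4 * N
  a+N≤4N N a≤N = ≤-trans (+-monoˡ-≤ N a≤N) (+-monoʳ-≤ N (m≤m+n N _))

[1+n]/2≤n : ∀ n → suc n / 2 ≤ n
[1+n]/2≤n n with s≤s h ← m/n<m (suc n) 2 (s≤s (s≤s z≤n)) = h

readFuel-fuel : ∀ {m} (δ′ : Fin m → Bool → Fin m) f f′ s k → k ≤ f → k ≤ f′ →
  readFuel δ′ f s k ≡ readFuel δ′ f′ s k
readFuel-fuel δ′ zero    zero     s zero    _ _ = refl
readFuel-fuel δ′ zero    (suc f′) s zero    _ _ = refl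
readFuel-fuel δ′ (suc f) zero     s zero    _ _ = refl
readFuel-fuel δ′ (suc f) (suc f′) s zero    _ _ = refl
readFuel-fuel δ′ (suc f) (suc f′) s (suc k) (s≤s k≤f) (s≤s k≤f′) =
  readFuel-fuel δ′ f f′ _ (suc k / 2) (≤-trans ([1+n]/2≤n k) k≤f) (≤-trans ([1+n]/2≤n k) k≤f′)

reach-pos : ∀ A p k → 1 ≤ k → reach A p k ≡ reach A (δ A p (bit k)) (k / 2)
reach-pos A p (suc k) _ = readFuel-fuel (δ A) k (suc k / 2) _ (suc k / 2) ([1+n]/2≤n k) ≤-refl

bit-% : ∀ k b → k % 2 ≡ digit b → bit k ≡ b
bit-% k false k%2≡0 rewrite k%2≡0 = refl
bit-% k true  k%2≡1 rewrite k%2≡1 = refl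

bit-digit : ∀ b m → bit (digit b + m * 2) ≡ b
bit-digit false m = bit-% (m * 2) false (m*n%n≡0 m 2)
bit-digit true  m = bit-% (1 + m * 2) true ([m+kn]%n≡m%n 1 m 2)

half-digit : ∀ b m → (digit b + m * 2) / 2 ≡ m
half-digit false m = m*n/n≡m m 2
half-digit true  m = trans (+-distrib-/ 1 (m * 2) 1+[m*2]%2<2) (m*n/n≡m m 2)
  where
  1+[m*2]%2<2 : 1 + (m * 2) % 2 < 2
  1+[m*2]%2<2 = subst (λ r → 1 + r < 2) (sym (m*n%n≡0 m 2)) ≤-refl

reach-digit : ∀ A p b m → 1 ≤ m → reach A p (digit b + m * 2) ≡ reach A (δ A p b) m
reach-digit A p b m 1≤m = trans (reach-pos A p (digit b + m * 2) (≤-trans 1≤m (≤-trans (m≤m*n m 2) (m≤n+m _ _))))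
  (cong₂ (λ b k → reach A (δ A p b) k) (bit-digit b m) (half-digit b m))

producedFrom : (A : Automaton) → Fin (n A) → Series
producedFrom A p = produced (withStart A p)

producedFrom-δ : ∀ A p b m → 1 ≤ m → producedFrom A (δ A p b) m ≡ section b (producedFrom A p) m
producedFrom-δ A p b m 1≤m = cong (out A) (sym (reach-digit A p b m 1≤m))

data EvenOrOdd : ℕ → Set where
  even : ∀ j → EvenOrOdd (j * 2)
  odd  : ∀ j → EvenOrOdd (suc (j * 2))

evenOrOdd : ∀ K → EvenOrOdd K
evenOrOdd zero = even 0
evenOrOdd (suc K) with evenOrOdd K
... | even j = odd j
... | odd  j = even (suc j)

module _ (A : Automaton) where

  SparselyPeriodic-δ-even : ∀ p b j → SparselyPeriodic (j * 2) (producedFrom A p) →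
    SparselyPeriodic j (producedFrom A (δ A p b))
  SparselyPeriodic-δ-even p b j =
    SparselyPeriodic-≡ᵉ j 1 (λ m 1≤m → sym (producedFrom-δ A p b m 1≤m))
    ∘ SparselyPeriodic-section {producedFrom A p} j b

  SparselyPeriodic-δ-odd : ∀ p b j → SparselyPeriodic (suc (j * 2)) (producedFrom A p) →
    SparselyPeriodic (suc (j * 2)) (producedFrom A (δ A p b))
  SparselyPeriodic-δ-odd p b j =
    SparselyPeriodic-δ-even p b (suc (j * 2)) ∘ SparselyPeriodic-*2 {producedFrom A p} (suc (j * 2))

  SparselyPeriodic-runWord-odd : ∀ w p j → SparselyPeriodic (suc (j * 2)) (producedFrom A p) →
    SparselyPeriodic (suc (j * 2)) (producedFrom A (runWord A p w))
  SparselyPeriodic-runWord-odd []      p j periodic = periodic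
  SparselyPeriodic-runWord-odd (b ∷ w) p j periodic =
    SparselyPeriodic-runWord-odd w (δ A p b) j (SparselyPeriodic-δ-odd p b j periodic)

  -- Each letter halves an even period, so within K letters the period has become odd.
  SparselyPeriodic-runWord : ∀ w p K → 1 ≤ K → K ≤ length w → SparselyPeriodic K (producedFrom A p) →
    ∃ λ j → SparselyPeriodic (suc (j * 2)) (producedFrom A (runWord A p w))
  SparselyPeriodic-runWord w p K 1≤K K≤|w| periodic with evenOrOdd K
  ... | odd j = j , SparselyPeriodic-runWord-odd w p j periodic
  SparselyPeriodic-runWord (b ∷ w) p .(suc j * 2) _ (s≤s j*2+1≤|w|) periodic | even (suc j) =
    SparselyPeriodic-runWord w (δ A p b) (suc j) (s≤s z≤n) (≤-trans (s≤s (m≤m*n j 2)) j*2+1≤|w|)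
      (SparselyPeriodic-δ-even p b (suc j) periodic)

  Sparse-δ-not : ∀ p j b → SparselyPeriodic (suc (j * 2)) (producedFrom A p) →
    Sparse (producedFrom A (δ A p b)) → Sparse (producedFrom A (δ A p (not b)))
  Sparse-δ-not p j b periodic =
    Sparse-≡ᵉ 1 (λ m 1≤m → sym (producedFrom-δ A p (not b) m 1≤m))
    ∘ SparselyPeriodic-odd-section {producedFrom A p} j b periodic
    ∘ Sparse-≡ᵉ 1 (producedFrom-δ A p b)

proposition12p4 : (A : Automaton) (v : Fin (n A)) →
    (∀ L → ∃ λ (w : List Bool) → L ≤ length w × runWord A (start A) w ≡ v) →
    ((Sparse (produced (withStart A (δ A v false))) × ¬ Sparse (produced (withStart A (δ A v true))))
      ⊎ (¬ Sparse (produced (withStart A (δ A v false))) × Sparse (produced (withStart A (δ A v true))))) →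
    ¬ InŜ (produced A)
proposition12p4 A v reaches-v exactly-one σ∈Ŝ
  with K , 1≤K , periodic ← InŜ⇒SparselyPeriodic (produced A) σ∈Ŝ
  with w , K≤|w| , w↦v ← reaches-v K
  with j , odd-periodic ← SparselyPeriodic-runWord A w (start A) K 1≤K K≤|w| periodic
  with v-periodic ← subst (SparselyPeriodic (suc (j * 2)) ∘ producedFrom A) w↦v odd-periodic
  with exactly-one
... | inj₁ (sparse₀ , ¬sparse₁) = ¬sparse₁ (Sparse-δ-not A v j false v-periodic sparse₀)
... | inj₂ (¬sparse₀ , sparse₁) = ¬sparse₀ (Sparse-δ-not A v j true v-periodic sparse₁)
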